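{- Let $\mathcal{I}$ be an instance of monotone 1-in-3 SAT with clauses $C_1,\ldots,C_m$ over variables $X_1,\ldots,X_n$, and let $(\mathcal{A},U,\mathsf{cost})$ be the min-cost popular instance input constructed from $\mathcal{I}$ as described in the context. There exists an instance $(\mathcal{A}\cup\mathcal{B},E)$ of cost $14m$ that admits a popular matching matching all people of $\mathcal{A}$ if and only if there exists a 1-in-3 satisfying assignment for $\mathcal{I}$.
   Context: Popular matchings: a preference instance is a bipartite graph $G=(\mathcal{A}\cup\mathcal{B},E)$ with $\mathcal{A}$ a set of people and $\mathcal{B}$ a set of items; each person ranks the items adjacent to her in order of preference; each item $b$ has a number $\mathsf{copies}(b)$ of copies. A matching $M$ assigns each person at most one acceptable item such that each item $b$ is assigned to at most $\mathsf{copies}(b)$ people; $M(a)$ is the item assigned to $a$. A person $a$ prefers $M$ to $M'$ if $a$ is matched in $M$ and unmatched in $M'$, or matched in both and prefers $M(a)$ to $M'(a)$. $M$ is more popular than $M'$ if more people prefer $M$ to $M'$ than prefer $M'$ to $M$; $M$ is popular if no matching is more popular than $M$. Min-cost popular instance problem: given a set $\mathcal{A}$ of people, each with a preference list over a universe $U$ of items, and a price $\mathsf{cost}(b)\ge 0$ for each $b\in U$, an instance is obtained by choosing integers $\mathsf{copies}(b)\ge 0$ for all $b\in U$; the item set $\mathcal{B}$ consists of the items with $\mathsf{copies}(b)>0$, each person's preference list is her original list restricted to these items (ranks determined by the relative order among present items), and the cost of the instance is $\sum_{b\in U}\mathsf{copies}(b)\,\mathsf{cost}(b)$. Monotone 1-in-3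 SAT: each clause consists of exactly 3 unnegated variables; a 1-in-3 satisfying assignment makes exactly one literal true in every clause. Construction: for each clause $C_i=(X_{j_1}\vee X_{j_2}\vee X_{j_3})$ there are 9 people $a^i_1,\ldots,a^i_9$ and internal items $p^i_1,p^i_2,p^i_3,q^i$; for each variable $X_j$ there is a public item $u_j$. Preference lists (first choice, then second choice): $a^i_1: u_{j_1},u_{j_2}$; $a^i_2: u_{j_2},u_{j_3}$; $a^i_3: u_{j_1},u_{j_3}$; $a^i_4: u_{j_1},p^i_1$; $a^i_5: u_{j_2},p^i_2$; $a^i_6: u_{j_3},p^i_3$; $a^i_7: p^i_1,q^i$; $a^i_8: p^i_2,q^i$; $a^i_9: p^i_3,q^i$. $\mathcal{A}=\bigcup_i\{a^i_1,\ldots,a^i_9\}$, $U=\{u_1,\ldots,u_n\}\cup\bigcup_i\{p^i_1,p^i_2,p^i_3,q^i\}$, with $\mathsf{cost}(p^i_t)=1$, $\mathsf{cost}(q^i)=0$, $\mathsf{cost}(u_j)=3$. -}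

module Defs where

open import Data.Nat using (ℕ; zero; suc; _+_; _*_; _≤_; _<ᵇ_)
open import Data.Bool using (Bool; true; false; if_then_else_)
open import Data.Fin using (Fin; zero; suc)
import Data.Fin as F
open import Data.List using (List; []; _∷_; _++_; length; filterᵇ; map; allFin; cartesianProduct; concatMap)
open import Data.List.Membership.Propositional using (_∈_)
open import Data.Nat.ListAction using (sum)
open import Data.Maybe using (Maybe; just; nothing)
open import Data.Product using (_×_; _,_; Σ; ∃)
open import Relation.Binary.PropositionalEquality using (_≡_; _≢_; refl; cong)
open import Relation.Binary.Definitions using (DecidableEquality)
open import Relation.Nullary using (yes; no; does; ¬_)

-- P       : type of people, enumerated (completely, without repetition) by 'people'
--   I       : type of items (the universe U), with decidable equality
--   pref a  : a's ORIGINAL preference list over U (most preferred first)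
--   copies  : the chosen number of copies of each item
-- The instance G has item set B = {b | copies b > 0}; each person's list is
-- her original list restricted to B.

module Popular {P I : Set} (_≟_ : DecidableEquality I) (people : List P)
               (pref : P → List I) (copies : I → ℕ) where

  present : I → Bool
  present b with copies b
  ... | zero  = false
  ... | suc _ = true

  prefList : P → List I
  prefList a = filterᵇ present (pref a)

  -- position of an item in a list (0 = first choice); length if absent
  rank : List I → I → ℕ
  rank []       b = zero
  rank (c ∷ cs) b = if does (c ≟ b) then zero else suc (rank cs b)

  countᵇ : (P → Bool) → ℕ
  countᵇ f = length (filterᵇ f people)

  isAssigned : Maybe I → I → Bool
  isAssigned nothing  b = false
  isAssigned (just c) b = does (c ≟ b)

  record Matching : Set where
    field
      assign     : P → Maybe I
      acceptable : ∀ a b → assign a ≡ just b → b ∈ prefList a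
      capacity   : ∀ b → countᵇ (λ a → isAssigned (assign a) b) ≤ copies b
  open Matching public

  prefers : P → Maybe I → Maybe I → Bool
  prefers a (just b) nothing  = true
  prefers a (just b) (just c) = rank (prefList a) b <ᵇ rank (prefList a) c
  prefers a nothing  _        = false

  votes : Matching → Matching → ℕ
  votes M M' = countᵇ (λ a → prefers a (assign M a) (assign M' a))

  MorePopular : Matching → Matching → Set
  MorePopular M M' = suc (votes M' M) ≤ votes M M'

  IsPopular : Matching → Set
  IsPopular M = ∀ (M' : Matching) → ¬ MorePopular M' M

  MatchesAll : Matching → Set
  MatchesAll M = ∀ a → ∃ λ b → assign M a ≡ just b

-- Monotone 1-in-3 SAT: n variables, m clauses, clause i = (j1, j2, j3).

Clause : ℕ → Set
Clause n = Fin n × Fin n × Fin n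

-- "exactly 3 variables": the three variables of a clause are distinct
DistinctVars : ∀ {n} → Clause n → Set
DistinctVars (j₁ , j₂ , j₃) = (j₁ ≢ j₂) × (j₂ ≢ j₃) × (j₁ ≢ j₃)

b2n : Bool → ℕ
b2n true  = 1
b2n false = 0

OneInThree : ∀ {n m} → (Fin m → Clause n) → (Fin n → Bool) → Set
OneInThree {m = m} cl x = ∀ (i : Fin m) → ClauseOK (cl i)
  where
    ClauseOK : _ → Set
    ClauseOK (j₁ , j₂ , j₃) = b2n (x j₁) + b2n (x j₂) + b2n (x j₃) ≡ 1

data Item (n m : ℕ) : Set where
  u : Fin n → Item n m
  p : Fin m → Fin 3 → Item n m    -- p^i_t  (t = 1,2,3 as Fin 3)
  q : Fin m → Item n m

_≟Item_ : ∀ {n m} → DecidableEquality (Item n m)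
u j   ≟Item u j'    with j F.≟ j'
... | yes refl = yes refl
... | no ne    = no λ { refl → ne refl }
p i t ≟Item p i' t' with i F.≟ i' | t F.≟ t'
... | yes refl | yes refl = yes refl
... | no ne    | _        = no λ { refl → ne refl }
... | yes _    | no ne    = no λ { refl → ne refl }
q i   ≟Item q i'    with i F.≟ i'
... | yes refl = yes refl
... | no ne    = no λ { refl → ne refl }
u _   ≟Item p _ _ = no λ ()
u _   ≟Item q _   = no λ ()
p _ _ ≟Item u _   = no λ ()
p _ _ ≟Item q _   = no λ ()
q _   ≟Item u _   = no λ ()
q _   ≟Item p _ _ = no λ ()

universe : ∀ n m → List (Item n m)
universe n m = map u (allFin n)
            ++ concatMap (λ i → map (p i) (allFin 3)) (allFin m)
            ++ map q (allFin m)

itemCost : ∀ {n m} → Item n m → ℕ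
itemCost (u _)   = 3
itemCost (p _ _) = 1
itemCost (q _)   = 0

-- person a^i_k is (i , k) with k : Fin 9 (k = 0 stands for a^i_1, ...)
Person : ℕ → Set
Person m = Fin m × Fin 9

allPeople : ∀ m → List (Person m)
allPeople m = cartesianProduct (allFin m) (allFin 9)

p₁ p₂ p₃ : ∀ {n m} → Fin m → Item n m
p₁ i = p i zero
p₂ i = p i (suc zero)
p₃ i = p i (suc (suc zero))

prefs : ∀ {n m} → (Fin m → Clause n) → Person m → List (Item n m)
prefs cl (i , k) with cl i
... | (j₁ , j₂ , j₃) = go k
  where
    go : Fin 9 → List _
    go zero                                                 = u j₁ ∷ u j₂ ∷ []
    go (suc zero)                                           = u j₂ ∷ u j₃ ∷ []
    go (suc (suc zero))                                     = u j₁ ∷ u j₃ ∷ []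
    go (suc (suc (suc zero)))                               = u j₁ ∷ p₁ i ∷ []
    go (suc (suc (suc (suc zero))))                         = u j₂ ∷ p₂ i ∷ []
    go (suc (suc (suc (suc (suc zero)))))                   = u j₃ ∷ p₃ i ∷ []
    go (suc (suc (suc (suc (suc (suc zero))))))             = p₁ i ∷ q i ∷ []
    go (suc (suc (suc (suc (suc (suc (suc zero)))))))       = p₂ i ∷ q i ∷ []
    go (suc (suc (suc (suc (suc (suc (suc (suc zero)))))))) = p₃ i ∷ q i ∷ []

module Constructed {n m : ℕ} (cl : Fin m → Clause n) (copies : Item n m → ℕ) =
  Popular _≟Item_ (allPeople m) (prefs cl) copies

costOf : ∀ {n m} → (Item n m → ℕ) → ℕ
costOf {n} {m} copies = sum (map (λ b → copies b * itemCost b) (universe n m))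

GoodInstanceExists : ∀ {n m} → (Fin m → Clause n) → Set
GoodInstanceExists {n} {m} cl =
  Σ (Item n m → ℕ) λ copies →
    (costOf copies ≡ 14 * m) ×
    Σ (Constructed.Matching cl copies) λ M →
      Constructed.IsPopular cl copies M × Constructed.MatchesAll cl copies M

-- Both directions rest on two general facts about popular matchings, proved
-- for an arbitrary instance whose people and items are listed without
-- repetition (module PopularMatchings):
--   * improving chains: if a holds mid but prefers an available top, and c
--     holds low but prefers mid, then giving top to a, mid to c and (if top is
--     full) nothing to one holder of top wins two votes against at most one,
--     so the matching is not popular (no-improving-chain);
--   * certificates: a matching that uses every copy and admits 0/1 item
--     prices paying for every vote a person could cast against it is popular,
--     since a competitor can hold no more price and so wins no more votes
--     (certified-popular).
-- Forward: in a popular matching of everybody, each clause gadget costs at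
-- least 12 plus the number of its present public items, at least two of which
-- are present; cost 14m forces exactly two, so "u_j absent" is a 1-in-3
-- satisfying assignment.  Backward: from a satisfying assignment we hand out
-- items clause by clause, buy exactly the copies used (cost 14 per clause)
-- and price the items to certify popularity.

module Submission where

open import Data.Bool using (Bool; true; false; not; _∨_; if_then_else_)
open import Data.Bool.Properties using (T-≡; ∨-zeroʳ)
open import Data.Empty using (⊥; ⊥-elim)
open import Data.Fin using (Fin; zero; suc; #_)
import Data.Fin as F
open import Data.List
  using (List; []; _∷_; _++_; length; map; filterᵇ; allFin; cartesianProduct; cartesianProductWith; concatMap)
open import Data.List.Properties using (map-++; map-∘; length-tabulate)
open import Data.List.Membership.Propositional using (_∈_)
open import Data.List.Membership.Propositional.Properties
  using (∈-filter⁻; ∈-filter⁺; ∈-map⁺; ∈-map⁻; ∈-++⁺ˡ; ∈-++⁺ʳ; ∈-++⁻; ∈-allFin;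
         ∈-cartesianProduct⁺; ∈-cartesianProductWith⁺; ∈-cartesianProductWith⁻)
open import Data.List.Relation.Binary.Disjoint.Propositional using (Disjoint)
open import Data.List.Relation.Unary.All as All using (All; []; _∷_)
open import Data.List.Relation.Unary.Any using (here; there)
open import Data.List.Relation.Unary.Unique.Propositional using (Unique; []; _∷_)
open import Data.List.Relation.Unary.Unique.Propositional.Properties
  using (map⁺; ++⁺; cartesianProduct⁺; cartesianProductWith⁺; allFin⁺)
open import Data.Maybe using (Maybe; just; nothing)
open import Data.Maybe.Properties using (just-injective)
open import Data.Nat using (ℕ; zero; suc; _+_; _*_; _≤_; z≤n; s≤s; _<ᵇ_)
open import Data.Nat.ListAction using (sum)
open import Data.Nat.ListAction.Properties using (sum-++)
open import Data.Nat.Properties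
open import Algebra.Properties.CommutativeSemigroup +-commutativeSemigroup
  using (interchange; xy∙z≈zy∙x; xy∙z≈xz∙y)
open import Data.Nat.Solver using (module +-*-Solver)
open import Data.Product using (_×_; _,_; Σ; proj₁; proj₂)
open import Data.Product.Properties using (≡-dec)
open import Data.Sum using (_⊎_; inj₁; inj₂)
open import Function using (_∘_)
open import Function.Bundles using (_⇔_; mk⇔; Equivalence)
open import Relation.Binary.Definitions using (DecidableEquality)
open import Relation.Binary.PropositionalEquality
open import Relation.Nullary using (yes; no; does; ¬_)
open import Relation.Nullary.Decidable using (T?)

open import Defs

∑ : {A : Set} → List A → (A → ℕ) → ℕ
∑ xs f = sum (map f xs)

module _ {A : Set} where

  ∑-congᴬ : {f g : A → ℕ} (xs : List A) → All (λ x → f x ≡ g x) xs → ∑ xs f ≡ ∑ xs g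
  ∑-congᴬ []       []           = refl
  ∑-congᴬ (x ∷ xs) (fx≡gx ∷ eq) = cong₂ _+_ fx≡gx (∑-congᴬ xs eq)

  ∑-cong : {f g : A → ℕ} (xs : List A) → (∀ x → f x ≡ g x) → ∑ xs f ≡ ∑ xs g
  ∑-cong xs f≡g = ∑-congᴬ xs (All.tabulate (λ {x} _ → f≡g x))

  ∑-mono : {f g : A → ℕ} (xs : List A) → (∀ x → f x ≤ g x) → ∑ xs f ≤ ∑ xs g
  ∑-mono []       f≤g = z≤n
  ∑-mono (x ∷ xs) f≤g = +-mono-≤ (f≤g x) (∑-mono xs f≤g)

  ∑-+ : (f g : A → ℕ) (xs : List A) → ∑ xs (λ x → f x + g x) ≡ ∑ xs f + ∑ xs g
  ∑-+ f g []       = refl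
  ∑-+ f g (x ∷ xs) = trans (cong (f x + g x +_) (∑-+ f g xs)) (interchange (f x) (g x) (∑ xs f) (∑ xs g))

  ∑-const : (xs : List A) (c : ℕ) → ∑ xs (λ _ → c) ≡ c * length xs
  ∑-const []       c = sym (*-zeroʳ c)
  ∑-const (x ∷ xs) c = trans (cong (c +_) (∑-const xs c)) (sym (*-suc c (length xs)))

  ∑-*ʳ : (f : A → ℕ) (c : ℕ) (xs : List A) → ∑ xs f * c ≡ ∑ xs (λ x → f x * c)
  ∑-*ʳ f c []       = refl
  ∑-*ʳ f c (x ∷ xs) = trans (*-distribʳ-+ c (f x) (∑ xs f)) (cong (f x * c +_) (∑-*ʳ f c xs))

  count≡∑ : (t : A → Bool) (xs : List A) → length (filterᵇ t xs) ≡ ∑ xs (b2n ∘ t)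
  count≡∑ t []       = refl
  count≡∑ t (x ∷ xs) with t x
  ... | true  = cong suc (count≡∑ t xs)
  ... | false = count≡∑ t xs

  ∑-update : {f g : A → ℕ} {a : A} (xs : List A) → Unique xs → a ∈ xs →
             (∀ y → y ≢ a → f y ≡ g y) → ∑ xs g + f a ≡ ∑ xs f + g a
  ∑-update {f} {g} {a} (a ∷ xs) (a∉xs ∷ _) (here refl) agree = begin
    g a + ∑ xs g + f a ≡⟨ cong (λ s → g a + s + f a) (∑-congᴬ xs (All.map (λ a≢y → sym (agree _ (a≢y ∘ sym))) a∉xs)) ⟩
    g a + ∑ xs f + f a ≡⟨ xy∙z≈zy∙x (g a) (∑ xs f) (f a) ⟩
    f a + ∑ xs f + g a ∎
    where open ≡-Reasoning
  ∑-update {f} {g} {a} (x ∷ xs) (x∉xs ∷ unique) (there a∈xs) agree = begin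
    g x + ∑ xs g + f a   ≡⟨ +-assoc (g x) (∑ xs g) (f a) ⟩
    g x + (∑ xs g + f a) ≡⟨ cong₂ _+_ (sym (agree x x≢a)) (∑-update xs unique a∈xs agree) ⟩
    f x + (∑ xs f + g a) ≡⟨ +-assoc (f x) (∑ xs f) (g a) ⟨
    f x + ∑ xs f + g a   ∎
    where
    open ≡-Reasoning
    x≢a : x ≢ a
    x≢a = All.lookup x∉xs a∈xs

  ∑-point : {f : A → ℕ} {a : A} (xs : List A) → Unique xs → a ∈ xs →
            (∀ y → y ≢ a → f y ≡ 0) → ∑ xs f ≡ f a
  ∑-point {f} {a} xs unique a∈xs vanish = begin
    ∑ xs f                  ≡⟨ +-identityʳ (∑ xs f) ⟨
    ∑ xs f + 0              ≡⟨ ∑-update xs unique a∈xs (λ y y≢a → sym (vanish y y≢a)) ⟩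
    ∑ xs (λ _ → 0) + f a    ≡⟨ cong (_+ f a) (∑-const xs 0) ⟩
    f a                     ∎
    where open ≡-Reasoning

  ∑-member : {f : A → ℕ} {x : A} (xs : List A) → x ∈ xs → f x ≤ ∑ xs f
  ∑-member {f} (y ∷ ys) (here refl) = m≤m+n (f y) (∑ ys f)
  ∑-member {f} (y ∷ ys) (there x∈ys) = ≤-trans (∑-member ys x∈ys) (m≤n+m (∑ ys f) (f y))

  ∑-positive : {f : A → ℕ} (xs : List A) → 1 ≤ ∑ xs f → Σ A (λ x → 1 ≤ f x)
  ∑-positive {f} (x ∷ xs) pos with f x in fx≡
  ... | zero  = ∑-positive xs pos
  ... | suc _ = x , subst (1 ≤_) (sym fx≡) (s≤s z≤n)

  ∑-squeeze : {f : A → ℕ} {c : ℕ} (xs : List A) → (∀ x → c ≤ f x) →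
              ∑ xs f ≤ ∑ xs (λ _ → c) → ∀ {x} → x ∈ xs → f x ≡ c
  ∑-squeeze {f} {c} (y ∷ ys) c≤f total (here refl) =
    ≤-antisym (+-cancelʳ-≤ (∑ ys f) (f y) c
                (≤-trans total (+-monoʳ-≤ c (∑-mono ys c≤f))))
              (c≤f y)
  ∑-squeeze {f} {c} (y ∷ ys) c≤f total (there x∈ys) =
    ∑-squeeze ys c≤f (+-cancelˡ-≤ c _ _ (≤-trans (+-monoˡ-≤ (∑ ys f) (c≤f y)) total)) x∈ys

∑-cartesianProduct : {A B : Set} (xs : List A) (ys : List B) (f : A × B → ℕ) →
  ∑ (cartesianProduct xs ys) f ≡ ∑ xs (λ x → ∑ ys (λ y → f (x , y)))
∑-cartesianProduct []       ys f = refl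
∑-cartesianProduct (x ∷ xs) ys f = begin
  sum (map f (map (x ,_) ys ++ cartesianProduct xs ys))
    ≡⟨ cong sum (map-++ f (map (x ,_) ys) _) ⟩
  sum (map f (map (x ,_) ys) ++ map f (cartesianProduct xs ys))
    ≡⟨ sum-++ (map f (map (x ,_) ys)) _ ⟩
  sum (map f (map (x ,_) ys)) + ∑ (cartesianProduct xs ys) f
    ≡⟨ cong₂ _+_ (cong sum (sym (map-∘ ys))) (∑-cartesianProduct xs ys f) ⟩
  ∑ ys (λ y → f (x , y)) + ∑ xs (λ x → ∑ ys (λ y → f (x , y))) ∎
  where open ≡-Reasoning

∑-swap : {A B : Set} (xs : List A) (ys : List B) (h : A → B → ℕ) →
  ∑ xs (λ x → ∑ ys (h x)) ≡ ∑ ys (λ y → ∑ xs (λ x → h x y))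
∑-swap []       ys h = sym (∑-const ys 0)
∑-swap (x ∷ xs) ys h =
  trans (cong (∑ ys (h x) +_) (∑-swap xs ys h)) (sym (∑-+ (h x) (λ y → ∑ xs (λ x → h x y)) ys))

∑-allFin-const : (m c : ℕ) → ∑ (allFin m) (λ _ → c) ≡ c * m
∑-allFin-const m c = trans (∑-const (allFin m) c) (cong (c *_) (length-tabulate (λ i → i)))

<ᵇ-irrefl : ∀ n → (n <ᵇ n) ≡ false
<ᵇ-irrefl zero    = refl
<ᵇ-irrefl (suc n) = <ᵇ-irrefl n

<ᵇ-asym : ∀ m n → (m <ᵇ n) ≡ true → (n <ᵇ m) ≡ false
<ᵇ-asym zero    (suc n) _  = refl
<ᵇ-asym (suc m) (suc n) lt = <ᵇ-asym m n lt

b2n≤1 : ∀ b → b2n b ≤ 1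
b2n≤1 true  = s≤s z≤n
b2n≤1 false = z≤n

∈-pair : {A : Set} {x y z : A} → z ∈ x ∷ y ∷ [] → z ≡ x ⊎ z ≡ y
∈-pair (here z≡x)         = inj₁ z≡x
∈-pair (there (here z≡y)) = inj₂ z≡y

-- Popular matchings in an arbitrary instance whose people and items are
-- enumerated without repetition.

module PopularMatchings
  {P I : Set} (_≟ₚ_ : DecidableEquality P) (_≟_ : DecidableEquality I)
  (people : List P) (people-unique : Unique people) (people-complete : ∀ a → a ∈ people)
  (items : List I) (items-unique : Unique items) (items-complete : ∀ b → b ∈ items)
  (pref : P → List I) (copies : I → ℕ) where

  open Popular _≟_ people pref copies public

  held : Maybe I → I → ℕ
  held mx b = b2n (isAssigned mx b)

  held-self : ∀ b → held (just b) b ≡ 1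
  held-self b rewrite ≡-≟-identity _≟_ {b} refl = refl

  held-other : ∀ {b c} → b ≢ c → held (just b) c ≡ 0
  held-other b≢c rewrite ≢-≟-identity _≟_ b≢c = refl

  held-positive : ∀ mx b → 1 ≤ held mx b → mx ≡ just b
  held-positive (just c) b pos with c ≟ b
  ... | yes refl = refl
  held-positive (just c) b () | no _

  load : (P → Maybe I) → I → ℕ
  load g b = ∑ people (λ a → held (g a) b)

  count≡load : ∀ (g : P → Maybe I) b → countᵇ (λ a → isAssigned (g a) b) ≡ load g b
  count≡load g b = count≡∑ (λ a → isAssigned (g a) b) people

  weight : (I → ℕ) → Maybe I → ℕ
  weight w nothing  = 0
  weight w (just b) = w b

  weighted-load : (g : P → Maybe I) (w : I → ℕ) →
                  ∑ items (λ b → load g b * w b) ≡ ∑ people (λ a → weight w (g a))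
  weighted-load g w = begin
    ∑ items (λ b → load g b * w b)
      ≡⟨ ∑-cong items (λ b → ∑-*ʳ (λ a → held (g a) b) (w b) people) ⟩
    ∑ items (λ b → ∑ people (λ a → held (g a) b * w b))
      ≡⟨ ∑-swap people items (λ a b → held (g a) b * w b) ⟨
    ∑ people (λ a → ∑ items (λ b → held (g a) b * w b))
      ≡⟨ ∑-cong people (λ a → held-weight (g a)) ⟩
    ∑ people (λ a → weight w (g a)) ∎
    where
    open ≡-Reasoning
    held-weight : ∀ mx → ∑ items (λ b → held mx b * w b) ≡ weight w mx
    held-weight nothing  = ∑-const items 0
    held-weight (just c) = begin
      ∑ items (λ b → held (just c) b * w b)
        ≡⟨ ∑-point items items-unique (items-complete c) (λ b b≢c → cong (_* w b) (held-other (b≢c ∘ sym))) ⟩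
      held (just c) c * w c ≡⟨ cong (_* w c) (held-self c) ⟩
      1 * w c               ≡⟨ *-identityˡ (w c) ⟩
      w c                   ∎

  matching-weight : (M : Matching) (w : I → ℕ) →
                    ∑ people (λ a → weight w (assign M a)) ≤ ∑ items (λ b → copies b * w b)
  matching-weight M w = begin
    ∑ people (λ a → weight w (assign M a)) ≡⟨ weighted-load (assign M) w ⟨
    ∑ items (λ b → load (assign M) b * w b)
      ≤⟨ ∑-mono items (λ b → *-monoˡ-≤ (w b) (subst (_≤ copies b) (count≡load (assign M) b) (capacity M b))) ⟩
    ∑ items (λ b → copies b * w b) ∎
    where open ≤-Reasoning

  prefers-irrefl : ∀ a mx → prefers a mx mx ≡ false
  prefers-irrefl a nothing  = refl
  prefers-irrefl a (just b) = <ᵇ-irrefl (rank (prefList a) b)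

  prefers-asym : ∀ a mx my → prefers a mx my ≡ true → prefers a my mx ≡ false
  prefers-asym a (just b) nothing  _  = refl
  prefers-asym a (just b) (just c) lt = <ᵇ-asym (rank (prefList a) b) (rank (prefList a) c) lt

  ∈-prefList⁻ : ∀ {a b} → b ∈ prefList a → b ∈ pref a × present b ≡ true
  ∈-prefList⁻ b∈ with ∈-filter⁻ (T? ∘ present) b∈
  ... | b∈pref , present-b = b∈pref , Equivalence.to T-≡ present-b

  ∈-prefList⁺ : ∀ {a b} → b ∈ pref a → present b ≡ true → b ∈ prefList a
  ∈-prefList⁺ b∈pref present-b = ∈-filter⁺ (T? ∘ present) b∈pref (Equivalence.from T-≡ present-b)

  prefList-pair : ∀ {a f s} → pref a ≡ f ∷ s ∷ [] → present f ≡ true → present s ≡ true →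
                  prefList a ≡ f ∷ s ∷ []
  prefList-pair {a} pref-a present-f present-s rewrite pref-a | present-f | present-s = refl

  prefers-pair : ∀ {a f s} → prefList a ≡ f ∷ s ∷ [] → f ≢ s →
                 prefers a (just f) (just s) ≡ true × prefers a (just s) (just f) ≡ false
  prefers-pair {a} {f} {s} list-a f≢s
    rewrite list-a | ≡-≟-identity _≟_ {f} refl | ≢-≟-identity _≟_ f≢s
    = refl , refl

  _[_≔_] : (P → Maybe I) → P → Maybe I → P → Maybe I
  (g [ a ≔ v ]) x with x ≟ₚ a
  ... | yes _ = v
  ... | no  _ = g x

  update-at : ∀ g a v → (g [ a ≔ v ]) a ≡ v
  update-at g a v with a ≟ₚ a
  ... | yes _   = refl
  ... | no a≢a = ⊥-elim (a≢a refl)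

  update-off : ∀ g {a x} v → x ≢ a → (g [ a ≔ v ]) x ≡ g x
  update-off g {a} {x} v x≢a with x ≟ₚ a
  ... | yes x≡a = ⊥-elim (x≢a x≡a)
  ... | no  _   = refl

  load-update : ∀ g a v b → load (g [ a ≔ v ]) b + held (g a) b ≡ load g b + held v b
  load-update g a v b =
    trans (∑-update people people-unique (people-complete a)
                    (λ x x≢a → cong (λ mx → held mx b) (sym (update-off g v x≢a))))
          (cong (λ mx → load g b + held mx b) (update-at g a v))

  Admissible : P → Maybe I → Set
  Admissible a mx = ∀ b → mx ≡ just b → b ∈ prefList a

  update-admissible : ∀ g a v → (∀ x → Admissible x (g x)) → Admissible a v →
                      ∀ x → Admissible x ((g [ a ≔ v ]) x)
  update-admissible g a v adm adm-v x with x ≟ₚ a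
  ... | yes refl = adm-v
  ... | no  _    = adm x

  δ : P → P → ℕ
  δ a x = b2n (does (x ≟ₚ a))

  δ-self : ∀ a → δ a a ≡ 1
  δ-self a rewrite ≡-≟-identity _≟ₚ_ {a} refl = refl

  δ-other : ∀ {a x} → x ≢ a → δ a x ≡ 0
  δ-other x≢a rewrite ≢-≟-identity _≟ₚ_ x≢a = refl

  ∑-δ : ∀ a → ∑ people (δ a) ≡ 1
  ∑-δ a = trans (∑-point people people-unique (people-complete a) (λ x → δ-other)) (δ-self a)

  votes≡∑ : ∀ M M' → votes M M' ≡ ∑ people (λ a → b2n (prefers a (assign M a) (assign M' a)))
  votes≡∑ M M' = count≡∑ (λ a → prefers a (assign M a) (assign M' a)) people

  beats : (M M' : Matching) (a c b : P) → a ≢ c →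
          (∀ x → x ≢ a → x ≢ c → x ≢ b → assign M' x ≡ assign M x) →
          prefers a (assign M' a) (assign M a) ≡ true →
          prefers c (assign M' c) (assign M c) ≡ true → MorePopular M' M
  beats M M' a c b a≢c unchanged gain-a gain-c = begin
    suc (votes M M')                               ≤⟨ s≤s losers ⟩
    2                                              ≡⟨ cong₂ _+_ (∑-δ a) (∑-δ c) ⟨
    ∑ people (δ a) + ∑ people (δ c)                ≡⟨ ∑-+ (δ a) (δ c) people ⟨
    ∑ people (λ x → δ a x + δ c x)                 ≤⟨ ∑-mono people gainer ⟩
    ∑ people (λ x → b2n (prefers x (g' x) (g x)))  ≡⟨ votes≡∑ M' M ⟨
    votes M' M                                     ∎
    where
    open ≤-Reasoning
    g g' : P → Maybe I
    g  = assign M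
    g' = assign M'
    gainer : ∀ x → δ a x + δ c x ≤ b2n (prefers x (g' x) (g x))
    gainer x with x ≟ₚ a | x ≟ₚ c
    ... | yes refl | yes refl = ⊥-elim (a≢c refl)
    ... | yes refl | no _    rewrite gain-a = ≤-refl
    ... | no _     | yes refl rewrite gain-c = ≤-refl
    ... | no _     | no _     = z≤n
    loser : ∀ x → b2n (prefers x (g x) (g' x)) ≤ δ b x
    loser x with x ≟ₚ a | x ≟ₚ c | x ≟ₚ b
    ... | yes refl | _        | _        rewrite prefers-asym a (g' a) (g a) gain-a = z≤n
    ... | no _     | yes refl | _        rewrite prefers-asym c (g' c) (g c) gain-c = z≤n
    ... | no _     | no _     | yes refl = b2n≤1 _
    ... | no x≢a   | no x≢c   | no x≢b
      rewrite unchanged x x≢a x≢c x≢b | prefers-irrefl x (g x) = z≤n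
    losers : votes M M' ≤ 1
    losers = begin
      votes M M'                                    ≡⟨ votes≡∑ M M' ⟩
      ∑ people (λ x → b2n (prefers x (g x) (g' x))) ≤⟨ ∑-mono people loser ⟩
      ∑ people (δ b)                                ≡⟨ ∑-δ b ⟩
      1                                             ∎

  present⇒copy : ∀ b → present b ≡ true → 1 ≤ copies b
  present⇒copy b present-b with copies b
  present⇒copy b ()        | zero
  ... | suc _ = s≤s z≤n

  -- Giving top to a and mid to c (and, if
  -- top has no free copy, taking top away from one of its holders b) yields a
  -- more popular matching.
  module Promotion (M : Matching) {a c : P} {top mid low : I} (a≢c : a ≢ c)
    (a-holds : assign M a ≡ just mid) (c-holds : assign M c ≡ just low) (top≢low : top ≢ low)
    (top-ok : top ∈ prefList a) (mid-ok : mid ∈ prefList c)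
    (a-gains : prefers a (just top) (just mid) ≡ true)
    (c-gains : prefers c (just mid) (just low) ≡ true) where

    g : P → Maybe I
    g = assign M

    raised : P → Maybe I
    raised = g [ a ≔ just top ]

    promoted : P → Maybe I
    promoted = raised [ c ≔ just mid ]

    promoted-a : promoted a ≡ just top
    promoted-a = trans (update-off raised (just mid) a≢c) (update-at g a (just top))

    promoted-c : promoted c ≡ just mid
    promoted-c = update-at raised c (just mid)

    promoted-off : ∀ {x} → x ≢ a → x ≢ c → promoted x ≡ g x
    promoted-off x≢a x≢c = trans (update-off raised (just mid) x≢c) (update-off g (just top) x≢a)

    promoted-admissible : ∀ x → Admissible x (promoted x)
    promoted-admissible =
      update-admissible raised c (just mid)
        (update-admissible g a (just top) (acceptable M) (λ { _ refl → top-ok }))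
        (λ { _ refl → mid-ok })

    promoted-load : ∀ d → load promoted d + held (just low) d ≡ load g d + held (just top) d
    promoted-load d = begin
      load promoted d + held (just low) d
        ≡⟨ cong (λ mx → load promoted d + held mx d) (trans (update-off g (just top) (a≢c ∘ sym)) c-holds) ⟨
      load promoted d + held (raised c) d ≡⟨ load-update raised c (just mid) d ⟩
      load raised d + held (just mid) d   ≡⟨ cong (λ mx → load raised d + held mx d) a-holds ⟨
      load raised d + held (g a) d        ≡⟨ load-update g a (just top) d ⟩
      load g d + held (just top) d        ∎
      where open ≡-Reasoning

    a-gains-in : ∀ {v} → v ≡ just top → prefers a v (g a) ≡ true
    a-gains-in a-top = subst₂ (λ v w → prefers a v w ≡ true) (sym a-top) (sym a-holds) a-gains

    c-gains-in : ∀ {v} → v ≡ just mid → prefers c v (g c) ≡ true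
    c-gains-in c-mid = subst₂ (λ v w → prefers c v w ≡ true) (sym c-mid) (sym c-holds) c-gains

    mid≢top : mid ≢ top
    mid≢top refl with trans (sym a-gains) (prefers-irrefl a (just top))
    ... | ()

    with-room : suc (load g top) ≤ copies top → ¬ IsPopular M
    with-room room popular = popular M₁ (beats M M₁ a c a a≢c (λ x x≢a x≢c _ → promoted-off x≢a x≢c)
                                                  (a-gains-in promoted-a) (c-gains-in promoted-c))
      where
      within : ∀ d → load promoted d ≤ copies d
      within d = ≤-trans (m≤m+n (load promoted d) (held (just low) d))
                         (≤-trans (≤-reflexive (promoted-load d)) (fits d))
        where
        fits : ∀ d → load g d + held (just top) d ≤ copies d
        fits d with top ≟ d
        ... | yes refl = subst (_≤ copies top) (+-comm 1 (load g top)) room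
        ... | no  _    = subst (_≤ copies d) (sym (+-identityʳ (load g d)))
                               (subst (_≤ copies d) (count≡load g d) (capacity M d))
      M₁ : Matching
      M₁ = record { assign = promoted ; acceptable = promoted-admissible
                  ; capacity = λ d → subst (_≤ copies d) (sym (count≡load promoted d)) (within d) }

    when-full : (b : P) → g b ≡ just top → ¬ IsPopular M
    when-full b b-holds popular = popular M₂ (beats M M₂ a c b a≢c unchanged
                                      (a-gains-in (trans (update-off promoted nothing a≢b) promoted-a))
                                      (c-gains-in (trans (update-off promoted nothing c≢b) promoted-c)))
      where
      a≢b : a ≢ b
      a≢b refl = mid≢top (just-injective (trans (sym a-holds) b-holds))
      c≢b : c ≢ b
      c≢b refl = top≢low (just-injective (trans (sym b-holds) c-holds))
      demoted : P → Maybe I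
      demoted = promoted [ b ≔ nothing ]
      unchanged : ∀ x → x ≢ a → x ≢ c → x ≢ b → demoted x ≡ g x
      unchanged x x≢a x≢c x≢b = trans (update-off promoted nothing x≢b) (promoted-off x≢a x≢c)
      -- top loses b and gains a: no item carries more load than before
      demoted-load : ∀ d → load demoted d + held (just low) d ≡ load g d
      demoted-load d = +-cancelʳ-≡ (held (just top) d) _ _ (begin
        load demoted d + held (just low) d + held (just top) d
          ≡⟨ xy∙z≈xz∙y (load demoted d) (held (just low) d) (held (just top) d) ⟩
        load demoted d + held (just top) d + held (just low) d
          ≡⟨ cong (λ mx → load demoted d + held mx d + held (just low) d)
                  (sym (trans (promoted-off (a≢b ∘ sym) (c≢b ∘ sym)) b-holds)) ⟩
        load demoted d + held (promoted b) d + held (just low) d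
          ≡⟨ cong (_+ held (just low) d) (trans (load-update promoted b nothing d) (+-identityʳ (load promoted d))) ⟩
        load promoted d + held (just low) d ≡⟨ promoted-load d ⟩
        load g d + held (just top) d ∎)
        where open ≡-Reasoning
      within : ∀ d → load demoted d ≤ copies d
      within d = ≤-trans (m≤m+n (load demoted d) (held (just low) d))
                   (subst (_≤ copies d) (trans (count≡load g d) (sym (demoted-load d))) (capacity M d))
      demoted-admissible : ∀ x → Admissible x (demoted x)
      demoted-admissible = update-admissible promoted b nothing promoted-admissible (λ _ ())
      M₂ : Matching
      M₂ = record { assign = demoted ; acceptable = demoted-admissible
                  ; capacity = λ d → subst (_≤ copies d) (sym (count≡load demoted d)) (within d) }

    not-popular : ¬ IsPopular M
    not-popular with suc (load g top) ≤? copies top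
    ... | yes room = with-room room
    ... | no full  with ∑-positive people (≤-trans (present⇒copy top (proj₂ (∈-prefList⁻ top-ok))) (≮⇒≥ full))
    ...   | b , positive = when-full b (held-positive (g b) top positive)

  no-improving-chain : (M : Matching) → IsPopular M → ∀ {a c top mid low} → a ≢ c →
    assign M a ≡ just mid → assign M c ≡ just low → top ≢ low →
    top ∈ prefList a → mid ∈ prefList c →
    prefers a (just top) (just mid) ≡ true → prefers c (just mid) (just low) ≡ true → ⊥
  no-improving-chain M popular a≢c a-holds c-holds top≢low top-ok mid-ok a-gains c-gains =
    Promotion.not-popular M a≢c a-holds c-holds top≢low top-ok mid-ok a-gains c-gains popular

  two-choice : (M : Matching) → MatchesAll M → ∀ {a f s} → pref a ≡ f ∷ s ∷ [] →
               (assign M a ≡ just f × present f ≡ true) ⊎ (assign M a ≡ just s × present s ≡ true)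
  two-choice M all {a} pref-a with all a
  ... | e , holds with ∈-prefList⁻ (acceptable M a e holds)
  ...   | e∈pref , present-e with ∈-pair (subst (e ∈_) pref-a e∈pref)
  ...     | inj₁ refl = inj₁ (holds , present-e)
  ...     | inj₂ refl = inj₂ (holds , present-e)

  -- For people a : [f, s] and c : [s, z], if f is present then a popular matching
  -- of everybody gives f to a or s to c: otherwise (f, s, z) is an improving chain.
  chain : (M : Matching) → IsPopular M → MatchesAll M → ∀ {a c f s z} → a ≢ c →
          pref a ≡ f ∷ s ∷ [] → pref c ≡ s ∷ z ∷ [] → f ≢ s → s ≢ z → f ≢ z →
          present f ≡ true → assign M a ≡ just f ⊎ assign M c ≡ just s
  chain M popular all {f = f} {s} a≢c pref-a pref-c f≢s s≢z f≢z present-f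
    with two-choice M all pref-a | two-choice M all pref-c
  ... | inj₁ (a-f , _)         | _                      = inj₁ a-f
  ... | inj₂ _                 | inj₁ (c-s , _)         = inj₂ c-s
  ... | inj₂ (a-s , present-s) | inj₂ (c-z , present-z) =
    ⊥-elim (no-improving-chain M popular a≢c a-s c-z f≢z
              (subst (f ∈_) (sym list-a) (here refl)) (subst (s ∈_) (sym list-c) (here refl))
              (proj₁ (prefers-pair list-a f≢s)) (proj₁ (prefers-pair list-c s≢z)))
    where
    list-a = prefList-pair pref-a present-f present-s
    list-c = prefList-pair pref-c present-s present-z

  -- Popularity certificates.  Weights w price the assignment my of person a
  -- if any vote a would cast for an admissible alternative mx is paid for by
  -- the weight difference.
  Priced : (I → ℕ) → P → Maybe I → Set
  Priced w a my = ∀ mx → Admissible a mx →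
                  b2n (prefers a mx my) + weight w my ≤ b2n (prefers a my mx) + weight w mx

  -- A matching using every copy whose assignments are all priced is popular:
  -- a competitor cannot hold more weight, so it cannot win more votes.
  certified-popular : (M : Matching) (w : I → ℕ) → (∀ b → copies b ≤ load (assign M) b) →
                      (∀ a → Priced w a (assign M a)) → IsPopular M
  certified-popular M w saturated priced M' more = <-irrefl refl (≤-trans more fewer)
    where
    S S' : ℕ
    S  = ∑ people (λ a → weight w (assign M a))
    S' = ∑ people (λ a → weight w (assign M' a))
    S'≤S : S' ≤ S
    S'≤S = begin
      S'                                        ≤⟨ matching-weight M' w ⟩
      ∑ items (λ b → copies b * w b)            ≤⟨ ∑-mono items (λ b → *-monoˡ-≤ (w b) (saturated b)) ⟩
      ∑ items (λ b → load (assign M) b * w b)   ≡⟨ weighted-load (assign M) w ⟩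
      S                                         ∎
      where open ≤-Reasoning
    balance : votes M' M + S ≤ votes M M' + S'
    balance = begin
      votes M' M + S
        ≡⟨ cong (_+ S) (votes≡∑ M' M) ⟩
      ∑ people (λ a → b2n (prefers a (assign M' a) (assign M a))) + S
        ≡⟨ ∑-+ (λ a → b2n (prefers a (assign M' a) (assign M a))) (λ a → weight w (assign M a)) people ⟨
      ∑ people (λ a → b2n (prefers a (assign M' a) (assign M a)) + weight w (assign M a))
        ≤⟨ ∑-mono people (λ a → priced a (assign M' a) (acceptable M' a)) ⟩
      ∑ people (λ a → b2n (prefers a (assign M a) (assign M' a)) + weight w (assign M' a))
        ≡⟨ ∑-+ (λ a → b2n (prefers a (assign M a) (assign M' a))) (λ a → weight w (assign M' a)) people ⟩
      ∑ people (λ a → b2n (prefers a (assign M a) (assign M' a))) + S'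
        ≡⟨ cong (_+ S') (votes≡∑ M M') ⟨
      votes M M' + S' ∎
      where open ≤-Reasoning
    fewer : votes M' M ≤ votes M M'
    fewer = +-cancelʳ-≤ S _ _ (≤-trans balance (+-monoʳ-≤ (votes M M') S'≤S))

  pair-priced : (w : I → ℕ) → (∀ b → w b ≤ 1) → ∀ {a f s e} →
                pref a ≡ f ∷ s ∷ [] → present e ≡ true →
                e ≡ f ⊎ (e ≡ s × (present f ≡ true → w f ≡ 1 × w s ≡ 0)) →
                Priced w a (just e)
  pair-priced w w≤1 {e = e} pref-a present-e holds nothing  _ = w≤1 e
  pair-priced w w≤1 {a} {e = e} pref-a present-e holds (just b) admissible with b ≟ e
  ... | yes refl rewrite prefers-irrefl a (just b) = ≤-refl
  ... | no b≢e with ∈-prefList⁻ (admissible b refl)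
  ...   | b∈pref , present-b with ∈-pair (subst (b ∈_) pref-a b∈pref) | holds
  ...     | inj₁ refl | inj₁ refl = ⊥-elim (b≢e refl)
  ...     | inj₂ refl | inj₂ (refl , _) = ⊥-elim (b≢e refl)
  ...     | inj₂ refl | inj₁ refl
    rewrite proj₁ (prefers-pair (prefList-pair pref-a present-e present-b) (b≢e ∘ sym))
          | proj₂ (prefers-pair (prefList-pair pref-a present-e present-b) (b≢e ∘ sym))
          = ≤-trans (w≤1 e) (s≤s z≤n)
  ...     | inj₁ refl | inj₂ (refl , costs)
    rewrite proj₁ (prefers-pair (prefList-pair pref-a present-b present-e) b≢e)
          | proj₂ (prefers-pair (prefList-pair pref-a present-b present-e) b≢e)
          | proj₁ (costs present-b) | proj₂ (costs present-b) = ≤-refl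

  load-present : ∀ (g : P → Maybe I) → (∀ b → copies b ≡ load g b) → ∀ a {b} → g a ≡ just b → present b ≡ true
  load-present g exact a {b} g-a = copy⇒present (begin
    1                  ≡⟨ held-self b ⟨
    held (just b) b    ≡⟨ cong (λ mx → held mx b) g-a ⟨
    held (g a) b       ≤⟨ ∑-member people (people-complete a) ⟩
    load g b           ≡⟨ exact b ⟨
    copies b           ∎)
    where
    open ≤-Reasoning
    copy⇒present : 1 ≤ copies b → present b ≡ true
    copy⇒present pos with copies b
    ... | suc _ = refl

  present-load : ∀ (g : P → Maybe I) → (∀ b → copies b ≡ load g b) → ∀ {b} → present b ≡ true → Σ P (λ a → g a ≡ just b)
  present-load g exact {b} present-b with ∑-positive people (subst (1 ≤_) (exact b) (present⇒copy b present-b))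
  ... | a , positive = a , held-positive (g a) b positive

-- The reduction from monotone 1-in-3 SAT.

var : ∀ {n} → Clause n → Fin 3 → Fin n
var (j₁ , _  , _ ) zero             = j₁
var (_  , j₂ , _ ) (suc zero)       = j₂
var (_  , _  , j₃) (suc (suc zero)) = j₃

concatMap-map : {A B C : Set} (f : A → B → C) (xs : List A) (ys : List B) →
                concatMap (λ x → map (f x) ys) xs ≡ cartesianProductWith f xs ys
concatMap-map f []       ys = refl
concatMap-map f (x ∷ xs) ys = cong (map (f x) ys ++_) (concatMap-map f xs ys)

∉-map : {A B : Set} {f : A → B} {v : B} (xs : List A) → (∀ x → f x ≢ v) → ¬ (v ∈ map f xs)
∉-map {f = f} xs misses v∈ with ∈-map⁻ f v∈
... | x , _ , v≡fx = misses x (sym v≡fx)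

module Enumerations (n m : ℕ) where

  _≟ₚ_ : DecidableEquality (Person m)
  _≟ₚ_ = ≡-dec F._≟_ F._≟_

  people-unique : Unique (allPeople m)
  people-unique = cartesianProduct⁺ (allFin⁺ m) (allFin⁺ 9)

  people-complete : ∀ a → a ∈ allPeople m
  people-complete (i , k) = ∈-cartesianProduct⁺ (∈-allFin i) (∈-allFin k)

  inner : List (Item n m)
  inner = cartesianProductWith p (allFin m) (allFin 3)

  universe≡ : universe n m ≡ map u (allFin n) ++ inner ++ map q (allFin m)
  universe≡ = cong (λ ps → map u (allFin n) ++ ps ++ map q (allFin m)) (concatMap-map p (allFin m) (allFin 3))

  ∉-inner : ∀ {v} → (∀ i t → p i t ≢ v) → ¬ (v ∈ inner)
  ∉-inner misses v∈ with ∈-cartesianProductWith⁻ p (allFin m) (allFin 3) v∈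
  ... | i , t , _ , _ , v≡pit = misses i t (sym v≡pit)

  universe-unique : Unique (universe n m)
  universe-unique = subst Unique (sym universe≡)
    (++⁺ (map⁺ (λ { refl → refl }) (allFin⁺ n))
         (++⁺ (cartesianProductWith⁺ p (λ { refl → refl , refl }) (allFin⁺ m) (allFin⁺ 3))
              (map⁺ (λ { refl → refl }) (allFin⁺ m))
              inner-q-disjoint)
         u-disjoint)
    where
    inner-q-disjoint : Disjoint inner (map q (allFin m))
    inner-q-disjoint (v∈inner , v∈qs) with ∈-map⁻ q v∈qs
    ... | _ , _ , refl = ∉-inner (λ _ _ ()) v∈inner
    u-disjoint : Disjoint (map u (allFin n)) (inner ++ map q (allFin m))
    u-disjoint (v∈us , v∈rest) with ∈-map⁻ u v∈us
    ... | _ , _ , refl with ∈-++⁻ inner v∈rest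
    ...   | inj₁ v∈inner = ∉-inner (λ _ _ ()) v∈inner
    ...   | inj₂ v∈qs    = ∉-map (allFin m) (λ _ ()) v∈qs

  universe-complete : ∀ b → b ∈ universe n m
  universe-complete b = subst (b ∈_) (sym universe≡) (listed b)
    where
    listed : ∀ b → b ∈ map u (allFin n) ++ inner ++ map q (allFin m)
    listed (u j)   = ∈-++⁺ˡ (∈-map⁺ u (∈-allFin j))
    listed (p i t) = ∈-++⁺ʳ (map u (allFin n)) (∈-++⁺ˡ (∈-cartesianProductWith⁺ p (∈-allFin i) (∈-allFin t)))
    listed (q i)   = ∈-++⁺ʳ (map u (allFin n)) (∈-++⁺ʳ inner (∈-map⁺ q (∈-allFin i)))

  module Theory (cl : Fin m → Clause n) (copies : Item n m → ℕ) =
    PopularMatchings _≟ₚ_ _≟Item_ (allPeople m) people-unique people-complete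
                     (universe n m) universe-unique universe-complete (prefs cl) copies

nine-sum : (c : Fin 9 → ℕ) {x y z : ℕ} → c (# 0) ≡ 3 → c (# 1) ≡ 3 → c (# 2) ≡ 3 →
           1 + x ≤ c (# 3) + c (# 6) → 1 + y ≤ c (# 4) + c (# 7) → 1 + z ≤ c (# 5) + c (# 8) →
           12 + (x + y + z) ≤ ∑ (allFin 9) c
nine-sum c {x} {y} {z} c₀ c₁ c₂ pair₁ pair₂ pair₃ rewrite c₀ | c₁ | c₂ =
  subst₂ _≤_ (lhs x y z) (rhs (c (# 3)) (c (# 4)) (c (# 5)) (c (# 6)) (c (# 7)) (c (# 8)))
         (+-monoʳ-≤ 9 (+-mono-≤ (+-mono-≤ pair₁ pair₂) pair₃))
  where
  open +-*-Solver
  lhs : ∀ x y z → 9 + ((1 + x) + (1 + y) + (1 + z)) ≡ 12 + (x + y + z)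
  lhs = solve 3 (λ x y z → con 9 :+ ((con 1 :+ x) :+ (con 1 :+ y) :+ (con 1 :+ z))
                         := con 12 :+ (x :+ y :+ z)) refl
  rhs : ∀ c₃ c₄ c₅ c₆ c₇ c₈ → 9 + ((c₃ + c₆) + (c₄ + c₇) + (c₅ + c₈))
                              ≡ 3 + (3 + (3 + (c₃ + (c₄ + (c₅ + (c₆ + (c₇ + (c₈ + 0))))))))
  rhs = solve 6 (λ c₃ c₄ c₅ c₆ c₇ c₈ → con 9 :+ ((c₃ :+ c₆) :+ (c₄ :+ c₇) :+ (c₅ :+ c₈))
                 := con 3 :+ (con 3 :+ (con 3 :+ (c₃ :+ (c₄ :+ (c₅ :+ (c₆ :+ (c₇ :+ (c₈ :+ con 0))))))))) refl

two-of-three : ∀ b₁ b₂ b₃ → b₁ ∨ b₂ ≡ true → b₂ ∨ b₃ ≡ true → b₁ ∨ b₃ ≡ true →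
               2 ≤ b2n b₁ + b2n b₂ + b2n b₃
two-of-three true  true  _     _  _  _  = s≤s (s≤s z≤n)
two-of-three true  false true  _  _  _  = s≤s (s≤s z≤n)
two-of-three false true  true  _  _  _  = s≤s (s≤s z≤n)
two-of-three true  false false _  () _
two-of-three false true  false _  _  ()
two-of-three false false _     () _  _

one-false : ∀ b₁ b₂ b₃ → b2n b₁ + b2n b₂ + b2n b₃ ≡ 2 →
            b2n (not b₁) + b2n (not b₂) + b2n (not b₃) ≡ 1
one-false true  true  false _ = refl
one-false true  false true  _ = refl
one-false false true  true  _ = refl
one-false true  true  true  ()
one-false true  false false ()
one-false false true  false ()
one-false false false true  ()
one-false false false false ()

module Forward {n m : ℕ} (cl : Fin m → Clause n) (copies : Item n m → ℕ) where
  open Enumerations n m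
  open Theory cl copies

  truth : Fin n → Bool
  truth j = not (present (u j))

  module _ (M : Matching) (popular : IsPopular M) (all : MatchesAll M) where

    cost : Person m → ℕ
    cost a = weight itemCost (assign M a)

    available : Fin m → Fin 3 → Bool
    available i t = present (u (var (cl i) t))

    availability : Fin m → ℕ
    availability i = b2n (available i (# 0)) + b2n (available i (# 1)) + b2n (available i (# 2))

    public-person : ∀ {a j j'} → prefs cl a ≡ u j ∷ u j' ∷ [] →
                    cost a ≡ 3 × present (u j) ∨ present (u j') ≡ true
    public-person pref-a with two-choice M all pref-a
    ... | inj₁ (holds , present-j)  rewrite holds | present-j  = refl , refl
    ... | inj₂ (holds , present-j') rewrite holds | present-j' = refl , ∨-zeroʳ _

    mixed-pays : ∀ {a j i t} → prefs cl a ≡ u j ∷ p i t ∷ [] → 1 ≤ cost a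
    mixed-pays pref-a with two-choice M all pref-a
    ... | inj₁ (holds , _) rewrite holds = s≤s z≤n
    ... | inj₂ (holds , _) rewrite holds = s≤s z≤n

    pair-cost : ∀ {a c j i t} → a ≢ c → prefs cl a ≡ u j ∷ p i t ∷ [] → prefs cl c ≡ p i t ∷ q i ∷ [] →
                1 + b2n (present (u j)) ≤ cost a + cost c
    pair-cost {a} {c} {j} a≢c pref-a pref-c with present (u j) in present-j
    ... | false = ≤-trans (mixed-pays pref-a) (m≤m+n (cost a) (cost c))
    ... | true with chain M popular all a≢c pref-a pref-c (λ ()) (λ ()) (λ ()) present-j
    ...   | inj₁ a-u rewrite a-u = s≤s (s≤s z≤n)
    ...   | inj₂ c-p rewrite c-p = +-monoˡ-≤ 1 (mixed-pays pref-a)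

    clause-bound : ∀ i → 12 + availability i ≤ ∑ (allFin 9) (λ k → cost (i , k))
    clause-bound i =
      nine-sum (λ k → cost (i , k)) (proj₁ (public-person {a = i , # 0} refl)) (proj₁ (public-person {a = i , # 1} refl))
               (proj₁ (public-person {a = i , # 2} refl))
               (pair-cost {a = i , # 3} {c = i , # 6} (λ ()) refl refl)
               (pair-cost {a = i , # 4} {c = i , # 7} (λ ()) refl refl)
               (pair-cost {a = i , # 5} {c = i , # 8} (λ ()) refl refl)

    -- since a^i_1, a^i_2, a^i_3 are matched, at least two public items of clause i are present
    at-least-two : ∀ i → 2 ≤ availability i
    at-least-two i = two-of-three (available i (# 0)) (available i (# 1)) (available i (# 2))
                       (proj₂ (public-person {a = i , # 0} refl))
                       (proj₂ (public-person {a = i , # 1} refl))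
                       (proj₂ (public-person {a = i , # 2} refl))

    -- at cost 14m every clause has exactly two public items present
    satisfying : costOf copies ≡ 14 * m → OneInThree cl truth
    satisfying cost≡ i = one-false (available i (# 0)) (available i (# 1)) (available i (# 2)) (+-cancelˡ-≡ 12 _ _ (∑-squeeze (allFin m) lower total (∈-allFin i)))
      where
      lower : ∀ i → 14 ≤ 12 + availability i
      lower i = +-monoʳ-≤ 12 (at-least-two i)
      total : ∑ (allFin m) (λ i → 12 + availability i) ≤ ∑ (allFin m) (λ _ → 14)
      total = begin
        ∑ (allFin m) (λ i → 12 + availability i)                 ≤⟨ ∑-mono (allFin m) clause-bound ⟩
        ∑ (allFin m) (λ i → ∑ (allFin 9) (λ k → cost (i , k)))  ≡⟨ ∑-cartesianProduct (allFin m) (allFin 9) cost ⟨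
        ∑ (allPeople m) cost                                     ≤⟨ matching-weight M itemCost ⟩
        costOf copies                                            ≡⟨ cost≡ ⟩
        14 * m                                                   ≡⟨ ∑-allFin-const m 14 ⟨
        ∑ (allFin m) (λ _ → 14)                                  ∎
        where open ≤-Reasoning

exclusive : ∀ b₁ b₂ b₃ → b2n b₁ + b2n b₂ + b2n b₃ ≡ 1 →
            (b₁ ≡ true → b₂ ≡ false) × (b₂ ≡ true → b₃ ≡ false) × (b₁ ≡ true → b₃ ≡ false)
exclusive true  false false _ = (λ _ → refl) , (λ ())       , (λ _ → refl)
exclusive false true  false _ = (λ ())       , (λ _ → refl) , (λ ())
exclusive false false true  _ = (λ ())       , (λ ())       , (λ ())
exclusive true  true  _     ()
exclusive true  false true  ()
exclusive false true  true  ()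
exclusive false false false ()

u-injective : ∀ {n m} {j j' : Fin n} → u {m = m} j ≡ u j' → j ≡ j'
u-injective refl = refl

module Backward {n m : ℕ} (cl : Fin m → Clause n) (x : Fin n → Bool) (ok : OneInThree cl x) where
  open Enumerations n m

  item : Person m → Item n m
  item (i , k) with cl i
  ... | (j₁ , j₂ , j₃) = offer k
    where
    offer : Fin 9 → Item n m
    offer zero                                                 = if x j₁ then u j₂ else u j₁
    offer (suc zero)                                           = if x j₂ then u j₃ else u j₂
    offer (suc (suc zero))                                     = if x j₁ then u j₃ else u j₁
    offer (suc (suc (suc zero)))                               = p₁ i
    offer (suc (suc (suc (suc zero))))                         = p₂ i
    offer (suc (suc (suc (suc (suc zero)))))                   = p₃ i
    offer (suc (suc (suc (suc (suc (suc zero))))))             = if x j₁ then q i else p₁ i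
    offer (suc (suc (suc (suc (suc (suc (suc zero)))))))       = if x j₂ then q i else p₂ i
    offer (suc (suc (suc (suc (suc (suc (suc (suc zero)))))))) = if x j₃ then q i else p₃ i

  -- each clause gadget buys 9 + 3 + 2 = 14: one of a^i_7, a^i_8, a^i_9 gets the free q^i
  clause-cost : ∀ i → ∑ (allFin 9) (λ k → itemCost (item (i , k))) ≡ 14
  clause-cost i with x (var (cl i) (# 0)) | x (var (cl i) (# 1)) | x (var (cl i) (# 2)) | ok i
  ... | true  | false | false | _ = refl
  ... | false | true  | false | _ = refl
  ... | false | false | true  | _ = refl
  ... | true  | true  | _     | ()
  ... | true  | false | true  | ()
  ... | false | true  | true  | ()
  ... | false | false | false | ()

  val : Fin m → Fin 3 → Bool
  val i t = x (var (cl i) t)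

  -- every item is present in exactly as many copies as it is handed out
  demand : Item n m → ℕ
  demand b = ∑ (allPeople m) (λ a → b2n (does (item a ≟Item b)))

  open Theory cl demand

  assignment : Person m → Maybe (Item n m)
  assignment a = just (item a)

  exact : ∀ b → demand b ≡ load assignment b
  exact b = refl

  item-present : ∀ a → present (item a) ≡ true
  item-present a = load-present assignment exact a refl

  if-∈ : ∀ {A : Set} b {f s : A} → (if b then s else f) ∈ f ∷ s ∷ []
  if-∈ true  = there (here refl)
  if-∈ false = here refl

  item-listed : ∀ a → item a ∈ prefs cl a
  item-listed (i , zero)                                                 = if-∈ (val i (# 0))
  item-listed (i , suc zero)                                             = if-∈ (val i (# 1))
  item-listed (i , suc (suc zero))                                       = if-∈ (val i (# 0))
  item-listed (i , suc (suc (suc zero)))                                 = there (here refl)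
  item-listed (i , suc (suc (suc (suc zero))))                           = there (here refl)
  item-listed (i , suc (suc (suc (suc (suc zero)))))                     = there (here refl)
  item-listed (i , suc (suc (suc (suc (suc (suc zero))))))               = if-∈ (val i (# 0))
  item-listed (i , suc (suc (suc (suc (suc (suc (suc zero)))))))         = if-∈ (val i (# 1))
  item-listed (i , suc (suc (suc (suc (suc (suc (suc (suc zero)))))))) = if-∈ (val i (# 2))

  fallback-false : ∀ j j' → (x j ≡ true → x j' ≡ false) → ∀ {j''} →
                   (if x j then u j' else u j) ≡ u {m = m} j'' → x j'' ≡ false
  fallback-false j j' exclusive-jj' held with x j in xj
  ... | true  = subst (λ v → x v ≡ false) (u-injective held) (exclusive-jj' refl)
  ... | false = subst (λ v → x v ≡ false) (u-injective held) xj

  inner-not-public : ∀ b {i : Fin m} {t : Fin 3} {j : Fin n} → (if b then q i else p i t) ≢ u j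
  inner-not-public true  ()
  inner-not-public false ()

  holder-false : ∀ a {j} → item a ≡ u j → x j ≡ false
  holder-false (i , zero)             = fallback-false _ _ (proj₁ (exclusive _ _ _ (ok i)))
  holder-false (i , suc zero)         = fallback-false _ _ (proj₁ (proj₂ (exclusive _ _ _ (ok i))))
  holder-false (i , suc (suc zero))   = fallback-false _ _ (proj₂ (proj₂ (exclusive _ _ _ (ok i))))
  holder-false (i , suc (suc (suc zero))) ()
  holder-false (i , suc (suc (suc (suc zero)))) ()
  holder-false (i , suc (suc (suc (suc (suc zero))))) ()
  holder-false (i , suc (suc (suc (suc (suc (suc zero))))))               = ⊥-elim ∘ inner-not-public (val i (# 0))
  holder-false (i , suc (suc (suc (suc (suc (suc (suc zero)))))))         = ⊥-elim ∘ inner-not-public (val i (# 1))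
  holder-false (i , suc (suc (suc (suc (suc (suc (suc (suc zero)))))))) = ⊥-elim ∘ inner-not-public (val i (# 2))

  present-false : ∀ {j} → present (u j) ≡ true → x j ≡ false
  present-false present-j with present-load assignment exact present-j
  ... | a , held = holder-false a (just-injective held)

  price : Item n m → ℕ
  price (u j)   = b2n (not (x j))
  price (p i t) = b2n (val i t)
  price (q i)   = 0

  price≤1 : ∀ b → price b ≤ 1
  price≤1 (u j)   = b2n≤1 (not (x j))
  price≤1 (p i t) = b2n≤1 (val i t)
  price≤1 (q i)   = z≤n

  Justified : Item n m → Item n m → Item n m → Set
  Justified f s e = e ≡ f ⊎ (e ≡ s × (present f ≡ true → price f ≡ 1 × price s ≡ 0))

  first-unless : ∀ b {f s} → (b ≡ true → present f ≡ true → price f ≡ 1 × price s ≡ 0) →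
                 Justified f s (if b then s else f)
  first-unless true  costs = inj₂ (refl , costs refl)
  first-unless false _     = inj₁ refl

  public-price : ∀ {j} → present (u j) ≡ true → price (u j) ≡ 1 × b2n (x j) ≡ 0
  public-price present-j rewrite present-false present-j = refl , refl

  true-absent : ∀ {j} → x j ≡ true → present (u j) ≡ true → ⊥
  true-absent xj present-j with trans (sym xj) (present-false present-j)
  ... | ()

  justified : ∀ a → Σ (Item n m) λ f → Σ (Item n m) λ s → prefs cl a ≡ f ∷ s ∷ [] × Justified f s (item a)
  justified (i , zero) =
    _ , _ , refl , first-unless (val i (# 0)) (λ xj present → ⊥-elim (true-absent xj present))
  justified (i , suc zero) =
    _ , _ , refl , first-unless (val i (# 1)) (λ xj present → ⊥-elim (true-absent xj present))
  justified (i , suc (suc zero)) =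
    _ , _ , refl , first-unless (val i (# 0)) (λ xj present → ⊥-elim (true-absent xj present))
  justified (i , suc (suc (suc zero)))                 = _ , _ , refl , inj₂ (refl , public-price)
  justified (i , suc (suc (suc (suc zero))))           = _ , _ , refl , inj₂ (refl , public-price)
  justified (i , suc (suc (suc (suc (suc zero)))))     = _ , _ , refl , inj₂ (refl , public-price)
  justified (i , suc (suc (suc (suc (suc (suc zero)))))) =
    _ , _ , refl , first-unless (val i (# 0)) (λ xj _ → cong b2n xj , refl)
  justified (i , suc (suc (suc (suc (suc (suc (suc zero))))))) =
    _ , _ , refl , first-unless (val i (# 1)) (λ xj _ → cong b2n xj , refl)
  justified (i , suc (suc (suc (suc (suc (suc (suc (suc zero)))))))) =
    _ , _ , refl , first-unless (val i (# 2)) (λ xj _ → cong b2n xj , refl)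

  priced : ∀ a → Priced price a (assignment a)
  priced a with justified a
  ... | _ , _ , pref-a , just-a = pair-priced price price≤1 pref-a (item-present a) just-a

  M : Matching
  M = record { assign     = assignment
             ; acceptable = λ { a _ refl → ∈-prefList⁺ (item-listed a) (item-present a) }
             ; capacity   = λ b → ≤-reflexive (count≡load assignment b) }

  popular : IsPopular M
  popular = certified-popular M price (λ b → ≤-refl) priced

  instance-cost : costOf demand ≡ 14 * m
  instance-cost = begin
    costOf demand                                                      ≡⟨ weighted-load assignment itemCost ⟩
    ∑ (allPeople m) (λ a → itemCost (item a))                          ≡⟨ ∑-cartesianProduct (allFin m) (allFin 9) _ ⟩
    ∑ (allFin m) (λ i → ∑ (allFin 9) (λ k → itemCost (item (i , k)))) ≡⟨ ∑-cong (allFin m) clause-cost ⟩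
    ∑ (allFin m) (λ _ → 14)                                            ≡⟨ ∑-allFin-const m 14 ⟩
    14 * m                                                             ∎
    where open ≡-Reasoning

  good-instance : GoodInstanceExists cl
  good-instance = demand , instance-cost , M , popular , λ a → item a , refl

-- Lemma 3.
lemma3 : (n m : ℕ) (cl : Fin m → Clause n) → (∀ i → DistinctVars (cl i)) →
    GoodInstanceExists cl ⇔ Σ (Fin n → Bool) (OneInThree cl)
lemma3 n m cl _ = mk⇔ forward backward
  where
  forward : GoodInstanceExists cl → Σ (Fin n → Bool) (OneInThree cl)
  forward (copies , cost≡ , M , popular , all) =
    Forward.truth cl copies , Forward.satisfying cl copies M popular all cost≡
  backward : Σ (Fin n → Bool) (OneInThree cl) → GoodInstanceExists cl
  backward (x , ok) = Backward.good-instance cl x ok
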